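{- Let $K$ be a non-archimedean real closed field and let $G\subseteq K$ be a value group section of $K$ with respect to the natural valuation. Then for each $x\in K$ there is $y\in G$ with $y>x$, and for each $y\in G$ there is $\varepsilon\in K$ such that $(y-\varepsilon,y+\varepsilon)\cap G=\{y\}$.
   Context: For a real closed field $K$, elements $x,y\in K$ are archimedean equivalent ($x\sim y$) if there is $n\in\mathbb{N}$ with $|x|<n|y|$ and $|y|<n|x|$. The natural valuation $\theta$ maps $K^\times$ onto its value group $\theta(K^\times)$, which is the ordered group of archimedean equivalence classes of nonzero elements (with multiplication induced from $K$). A value group section of $K$ is the image of a group embedding $f:\theta(K^\times)\to (K^{>0},\cdot)$ which intersects each $\sim$-equivalence class in exactly one element. -}

module Defs where

open import Level using (Level; _⊔_) renaming (suc to lsuc)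
open import Data.Nat as ℕ using (ℕ; zero; suc)
open import Data.List using (List; []; _∷_; length)
open import Data.Product using (Σ; ∃; _×_; _,_; proj₁)
open import Relation.Nullary using (¬_)
open import Relation.Binary using (Rel; IsStrictTotalOrder; tri<; tri≈; tri>)
open import Relation.Binary.PropositionalEquality using (_≡_)
open import Algebra.Bundles using (CommutativeRing)

-- Polynomials as coefficient lists [a₀, a₁, …, aₙ]; Horner evaluation.
module _ {c ℓ} (R : CommutativeRing c ℓ) where
  open CommutativeRing R
  evalPoly : List Carrier → Carrier → Carrier
  evalPoly []       x = 0#
  evalPoly (a ∷ as) x = a + x * evalPoly as x

  polyWithLead : List Carrier → Carrier → List Carrier
  polyWithLead []       an = an ∷ []
  polyWithLead (a ∷ as) an = a ∷ polyWithLead as an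

record RealClosedField (c ℓ₁ ℓ₂ : Level) : Set (lsuc (c ⊔ ℓ₁ ⊔ ℓ₂)) where
  field
    commutativeRing : CommutativeRing c ℓ₁
  open CommutativeRing commutativeRing public
  field
    _<_                : Rel Carrier ℓ₂
    isStrictTotalOrder : IsStrictTotalOrder _≈_ _<_
  infix 4 _<_
  field
    0<1                : 0# < 1#
    +-monoˡ-<          : ∀ {x y} z → x < y → (x + z) < (y + z)
    *-pos              : ∀ {x y} → 0# < x → 0# < y → 0# < (x * y)
    inverse            : ∀ x → ¬ (x ≈ 0#) → ∃ λ y → x * y ≈ 1#
    sqrt               : ∀ x → 0# < x → ∃ λ y → y * y ≈ x
    oddRoot            : ∀ (as : List Carrier) (an : Carrier) → ¬ (an ≈ 0#) →
                         (∃ λ k → length as ≡ suc (2 ℕ.* k)) →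
                         ∃ λ x → evalPoly commutativeRing (polyWithLead commutativeRing as an) x ≈ 0#
  open IsStrictTotalOrder isStrictTotalOrder public using (compare)

module RCF {c ℓ₁ ℓ₂} (K : RealClosedField c ℓ₁ ℓ₂) where
  open RealClosedField K

  fromℕ : ℕ → Carrier
  fromℕ zero    = 0#
  fromℕ (suc n) = 1# + fromℕ n

  ∣_∣ : Carrier → Carrier
  ∣ x ∣ with compare x 0#
  ... | tri< _ _ _ = - x
  ... | tri≈ _ _ _ = x
  ... | tri> _ _ _ = x

  _∼_ : Carrier → Carrier → Set ℓ₂
  x ∼ y = ∃ λ (n : ℕ) → (∣ x ∣ < (fromℕ n * ∣ y ∣)) × (∣ y ∣ < (fromℕ n * ∣ x ∣))

  NonArchimedean : Set (c ⊔ ℓ₂)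
  NonArchimedean = ∃ λ (x : Carrier) → ∀ (n : ℕ) → fromℕ n < x

  -- nonzero elements K^×; the value group θ(K^×) is K^× modulo ∼,
  -- with multiplication induced from K
  K× : Set (c ⊔ ℓ₁)
  K× = Σ Carrier λ x → ¬ (x ≈ 0#)

  -- A group embedding f : θ(K^×) → (K^{>0}, ·), presented as a map on K^×
  -- which is constant on ∼-classes (well defined on the quotient),
  -- multiplicative, injective on the quotient, with positive values,
  -- whose image meets every ∼-class of K^× in exactly one element.
  record ValueGroupEmbedding : Set (c ⊔ ℓ₁ ⊔ ℓ₂) where
    field
      f         : K× → Carrier
      f-cong    : ∀ (a b : K×) → proj₁ a ∼ proj₁ b → f a ≈ f b
      f-hom     : ∀ (a b ab : K×) → proj₁ ab ≈ proj₁ a * proj₁ b → f ab ≈ f a * f b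
      f-inj     : ∀ (a b : K×) → f a ≈ f b → proj₁ a ∼ proj₁ b
      f-pos     : ∀ (a : K×) → 0# < f a
      meets     : ∀ (a : K×) → ∃ λ (b : K×) → f b ∼ proj₁ a
      meetsOnce : ∀ (a b b′ : K×) → f b ∼ proj₁ a → f b′ ∼ proj₁ a → f b ≈ f b′

    _∈G : Carrier → Set (c ⊔ ℓ₁)
    y ∈G = ∃ λ (a : K×) → y ≈ f a

module Submission where

-- Both claims only use that K is an ordered field and that
-- every element of G is positive and ∼-equivalent to exactly one element of G.
--
-- * G is cofinal in K: for x > 0 take an infinite X and the element f b ∈ G
--   with f b ∼ x·X.  Then x·X < m·f b for some m ∈ ℕ, while m·x < X·x; so
--   f b ≤ x would give x·X < m·x < x·X.  For x ≤ 0 any element of G works.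
-- * G is discrete: for y ∈ G put ε = y/2.  If z ∈ G lies in (y - ε, y + ε)
--   then z < 2y and y < 2z, so z ∼ y; as also y ∼ y, uniqueness of the element
--   of G in the class of y forces z ≈ y.

open import Defs
open import Level using (_⊔_)
open import Data.Product using (∃; _×_; _,_; proj₁; proj₂)
open import Data.Sum using (_⊎_; inj₁; inj₂)
open import Data.Nat using (ℕ; zero; suc)
open import Data.Empty using (⊥-elim)
open import Relation.Nullary using (¬_)
open import Relation.Binary using (tri<; tri≈; tri>; IsStrictTotalOrder)
import Algebra.Properties.Ring as RingProperties
import Relation.Binary.Reasoning.Setoid as SetoidReasoning

module OrderedFieldFacts {c ℓ₁ ℓ₂} (K : RealClosedField c ℓ₁ ℓ₂) where
  open RealClosedField K
  open RCF K
  open IsStrictTotalOrder isStrictTotalOrder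
    using (irrefl; <-respʳ-≈; <-respˡ-≈) renaming (trans to <-trans)
  open RingProperties ring using (-‿distribʳ-*)
  open SetoidReasoning setoid

  infix 4 _≤_
  _≤_ : Carrier → Carrier → Set (ℓ₁ ⊔ ℓ₂)
  a ≤ b = a < b ⊎ a ≈ b

  <-resp-≈ : ∀ {a b a′ b′} → a ≈ a′ → b ≈ b′ → a < b → a′ < b′
  <-resp-≈ p q r = <-respˡ-≈ p (<-respʳ-≈ q r)

  ≤-resp-≈ : ∀ {a b a′ b′} → a ≈ a′ → b ≈ b′ → a ≤ b → a′ ≤ b′
  ≤-resp-≈ p q (inj₁ a<b) = inj₁ (<-resp-≈ p q a<b)
  ≤-resp-≈ p q (inj₂ a≈b) = inj₂ (trans (sym p) (trans a≈b q))

  <-≤-trans : ∀ {a b d} → a < b → b ≤ d → a < d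
  <-≤-trans p (inj₁ q) = <-trans p q
  <-≤-trans p (inj₂ q) = <-respʳ-≈ q p

  ¬≤⇒> : ∀ {a b} → ¬ (b ≤ a) → a < b
  ¬≤⇒> {a} {b} b≰a with compare b a
  ... | tri< b<a _ _ = ⊥-elim (b≰a (inj₁ b<a))
  ... | tri≈ _ b≈a _ = ⊥-elim (b≰a (inj₂ b≈a))
  ... | tri> _ _ a<b = a<b

  pos⇒≉0 : ∀ {u} → 0# < u → ¬ (u ≈ 0#)
  pos⇒≉0 0<u u≈0 = irrefl (sym u≈0) 0<u

  +-monoʳ-< : ∀ {x y} z → x < y → z + x < z + y
  +-monoʳ-< {x} {y} z x<y = <-resp-≈ (+-comm x z) (+-comm y z) (+-monoˡ-< z x<y)

  +-monoʳ-≤ : ∀ {x y} z → x ≤ y → z + x ≤ z + y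
  +-monoʳ-≤ z (inj₁ x<y) = inj₁ (+-monoʳ-< z x<y)
  +-monoʳ-≤ z (inj₂ x≈y) = inj₂ (+-congˡ x≈y)

  +-mono-< : ∀ {a b d e} → a < b → d < e → a + d < b + e
  +-mono-< {a} {b} {d} a<b d<e = <-trans (+-monoˡ-< d a<b) (+-monoʳ-< b d<e)

  <+pos : ∀ {u} v → 0# < u → v < v + u
  <+pos v 0<u = <-respˡ-≈ (+-identityʳ v) (+-monoʳ-< v 0<u)

  -pos< : ∀ {u} v → 0# < u → v - u < v
  -pos< {u} v 0<u = <-respʳ-≈ (+-identityʳ v) (+-monoʳ-< v -u<0)
    where
    -u<0 : - u < 0#
    -u<0 = <-resp-≈ (+-identityˡ (- u)) (-‿inverseʳ u) (+-monoˡ-< (- u) 0<u)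

  <⇒0<- : ∀ {a b} → a < b → 0# < b - a
  <⇒0<- {a} a<b = <-respˡ-≈ (-‿inverseʳ a) (+-monoˡ-< (- a) a<b)

  0<-⇒< : ∀ {a b} → 0# < b - a → a < b
  0<-⇒< {a} {b} 0<b-a = <-resp-≈ (+-identityˡ a) b-a+a≈b (+-monoˡ-< a 0<b-a)
    where
    b-a+a≈b : (b - a) + a ≈ b
    b-a+a≈b = begin
      (b - a) + a   ≈⟨ +-assoc b (- a) a ⟩
      b + (- a + a) ≈⟨ +-congˡ (-‿inverseˡ a) ⟩
      b + 0#        ≈⟨ +-identityʳ b ⟩
      b             ∎

  *-monoˡ-< : ∀ {a b} d → 0# < d → a < b → d * a < d * b
  *-monoˡ-< {a} {b} d 0<d a<b = 0<-⇒< (<-respʳ-≈ d[b-a]≈db-da (*-pos 0<d (<⇒0<- a<b)))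
    where
    d[b-a]≈db-da : d * (b - a) ≈ d * b - d * a
    d[b-a]≈db-da = begin
      d * (b - a)       ≈⟨ distribˡ d b (- a) ⟩
      d * b + d * - a   ≈⟨ +-congˡ (sym (-‿distribʳ-* d a)) ⟩
      d * b - d * a     ∎

  *-monoˡ-≤ : ∀ {a b} d → 0# ≤ d → a ≤ b → d * a ≤ d * b
  *-monoˡ-≤ d (inj₁ 0<d) (inj₁ a<b) = inj₁ (*-monoˡ-< d 0<d a<b)
  *-monoˡ-≤ d (inj₁ 0<d) (inj₂ a≈b) = inj₂ (*-congˡ a≈b)
  *-monoˡ-≤ {a} {b} d (inj₂ 0≈d) _ = inj₂ (begin
    d * a   ≈⟨ *-congʳ (sym 0≈d) ⟩
    0# * a  ≈⟨ zeroˡ a ⟩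
    0#      ≈⟨ sym (zeroˡ b) ⟩
    0# * b  ≈⟨ *-congʳ 0≈d ⟩
    d * b   ∎)

  fromℕ-nonneg : ∀ n → 0# ≤ fromℕ n
  fromℕ-suc-pos : ∀ n → 0# < fromℕ (suc n)

  fromℕ-nonneg zero    = inj₂ refl
  fromℕ-nonneg (suc n) = inj₁ (fromℕ-suc-pos n)

  fromℕ-suc-pos n =
    <-≤-trans (<-respʳ-≈ (sym (+-identityʳ 1#)) 0<1) (+-monoʳ-≤ 1# (fromℕ-nonneg n))

  two*≈+ : ∀ u → fromℕ 2 * u ≈ u + u
  two*≈+ u = begin
    (1# + (1# + 0#)) * u  ≈⟨ *-congʳ (+-congˡ (+-identityʳ 1#)) ⟩
    (1# + 1#) * u         ≈⟨ distribʳ u 1# 1# ⟩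
    1# * u + 1# * u       ≈⟨ +-cong (*-identityˡ u) (*-identityˡ u) ⟩
    u + u                 ∎

  ∣pos∣ : ∀ u → 0# < u → ∣ u ∣ ≈ u
  ∣pos∣ u 0<u with compare u 0#
  ... | tri< u<0 _ _ = ⊥-elim (irrefl refl (<-trans u<0 0<u))
  ... | tri≈ _ _ _   = refl
  ... | tri> _ _ _   = refl

  half : ∀ y → 0# < y → ∃ λ ε → 0# < ε × ε + ε ≈ y
  half y 0<y = y * h , *-pos 0<y 0<h , yh+yh≈y
    where
    two : Carrier
    two = fromℕ 2
    h : Carrier
    h = proj₁ (inverse two (pos⇒≉0 (fromℕ-suc-pos 1)))
    two*h≈1 : two * h ≈ 1#
    two*h≈1 = proj₂ (inverse two (pos⇒≉0 (fromℕ-suc-pos 1)))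
    0<h : 0# < h
    0<h = ¬≤⇒> λ h≤0 → irrefl refl (<-≤-trans 0<1
      (≤-resp-≈ two*h≈1 (zeroʳ two) (*-monoˡ-≤ two (fromℕ-nonneg 2) h≤0)))
    yh+yh≈y : y * h + y * h ≈ y
    yh+yh≈y = begin
      y * h + y * h  ≈⟨ sym (distribˡ y h h) ⟩
      y * (h + h)    ≈⟨ *-congˡ (sym (two*≈+ h)) ⟩
      y * (two * h)  ≈⟨ *-congˡ two*h≈1 ⟩
      y * 1#         ≈⟨ *-identityʳ y ⟩
      y              ∎

  within-two⇒∼ : ∀ {u v} → 0# < u → 0# < v → u < v + v → v < u + u → u ∼ v
  within-two⇒∼ {u} {v} 0<u 0<v u<2v v<2u =
    2 , <-resp-≈ (sym (∣pos∣ u 0<u)) (*-congˡ (sym (∣pos∣ v 0<v))) (<-respʳ-≈ (sym (two*≈+ v)) u<2v)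
      , <-resp-≈ (sym (∣pos∣ v 0<v)) (*-congˡ (sym (∣pos∣ u 0<u))) (<-respʳ-≈ (sym (two*≈+ u)) v<2u)

  ≈⇒∼ : ∀ {u v} → 0# < u → u ≈ v → u ∼ v
  ≈⇒∼ {u} {v} 0<u u≈v = within-two⇒∼ 0<u 0<v
    (<-respʳ-≈ (+-cong u≈v u≈v) (<+pos u 0<u)) (<-resp-≈ u≈v refl (<+pos u 0<u))
    where
    0<v : 0# < v
    0<v = <-respʳ-≈ u≈v 0<u

  halves⇒- : ∀ {ε y} → ε + ε ≈ y → y - ε ≈ ε
  halves⇒- {ε} {y} ε+ε≈y = begin
    y - ε         ≈⟨ +-congʳ (sym ε+ε≈y) ⟩
    ε + ε - ε     ≈⟨ +-assoc ε ε (- ε) ⟩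
    ε + (ε - ε)   ≈⟨ +-congˡ (-‿inverseʳ ε) ⟩
    ε + 0#        ≈⟨ +-identityʳ ε ⟩
    ε             ∎

  halves⇒< : ∀ {ε y} → 0# < ε → ε + ε ≈ y → ε < y
  halves⇒< {ε} 0<ε ε+ε≈y = <-respʳ-≈ ε+ε≈y (<+pos ε 0<ε)

module ValueGroupSectionFacts {c ℓ₁ ℓ₂} (K : RealClosedField c ℓ₁ ℓ₂)
                              (S : RCF.ValueGroupEmbedding K) where
  open RealClosedField K
  open RCF K
  open ValueGroupEmbedding S
  open OrderedFieldFacts K
  open IsStrictTotalOrder isStrictTotalOrder
    using (irrefl; <-respʳ-≈; <-respˡ-≈) renaming (trans to <-trans)

  G-pos : ∀ {y} → y ∈G → 0# < y
  G-pos (a , y≈fa) = <-respʳ-≈ (sym y≈fa) (f-pos a)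

  one : K×
  one = 1# , pos⇒≉0 0<1

  -- Above every positive x lies an element of G: the representative of the
  -- class of x·X, for X infinite, cannot be ≤ x.
  cofinal-pos : NonArchimedean → ∀ x → 0# < x → ∃ λ b → x < f b
  cofinal-pos (X , X-infinite) x 0<x = b , x<fb
    where
    0<xX : 0# < x * X
    0<xX = *-pos 0<x (X-infinite 0)
    b : K×
    b = proj₁ (meets (x * X , pos⇒≉0 0<xX))
    m : ℕ
    m = proj₁ (proj₂ (meets (x * X , pos⇒≉0 0<xX)))
    xX<m·fb : x * X < fromℕ m * f b
    xX<m·fb = <-resp-≈ (∣pos∣ _ 0<xX) (*-congˡ (∣pos∣ _ (f-pos b)))
                       (proj₂ (proj₂ (proj₂ (meets (x * X , pos⇒≉0 0<xX)))))
    m·x<xX : fromℕ m * x < x * X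
    m·x<xX = <-respˡ-≈ (*-comm x (fromℕ m)) (*-monoˡ-< x 0<x (X-infinite m))
    x<fb : x < f b
    x<fb = ¬≤⇒> λ fb≤x → irrefl refl
      (<-trans (<-≤-trans xX<m·fb (*-monoˡ-≤ (fromℕ m) (fromℕ-nonneg m) fb≤x)) m·x<xX)

  cofinal : NonArchimedean → ∀ x → ∃ λ y → y ∈G × x < y
  cofinal non-arch x with compare x 0#
  ... | tri< x<0 _ _ = f one , (one , refl) , <-trans x<0 (f-pos one)
  ... | tri≈ _ x≈0 _ = f one , (one , refl) , <-respˡ-≈ (sym x≈0) (f-pos one)
  ... | tri> _ _ 0<x = let (b , x<fb) = cofinal-pos non-arch x 0<x
                       in f b , (b , refl) , x<fb

  isolated : ∀ y → y ∈G → ∃ λ ε → ∀ z → z ∈G →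
               ((y - ε < z × z < y + ε) → z ≈ y) × (z ≈ y → (y - ε < z × z < y + ε))
  isolated y (a , y≈fa) = ε , λ z z∈G → inside⇒≈ z z∈G , ≈⇒inside z
    where
    0<y : 0# < y
    0<y = G-pos (a , y≈fa)
    ε : Carrier
    ε = proj₁ (half y 0<y)
    0<ε : 0# < ε
    0<ε = proj₁ (proj₂ (half y 0<y))
    ε+ε≈y : ε + ε ≈ y
    ε+ε≈y = proj₂ (proj₂ (half y 0<y))

    fa∼y : f a ∼ y
    fa∼y = ≈⇒∼ (f-pos a) (sym y≈fa)

    inside⇒≈ : ∀ z → z ∈G → (y - ε < z × z < y + ε) → z ≈ y
    inside⇒≈ z (b , z≈fb) (y-ε<z , z<y+ε) = trans z≈fb (trans (sym fa≈fb) (sym y≈fa))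
      where
      ε<z : ε < z
      ε<z = <-respˡ-≈ (halves⇒- ε+ε≈y) y-ε<z
      fb∼y : f b ∼ y
      fb∼y = within-two⇒∼ (f-pos b) 0<y
        (<-respˡ-≈ z≈fb (<-trans z<y+ε (+-monoʳ-< y (halves⇒< 0<ε ε+ε≈y))))
        (<-resp-≈ ε+ε≈y (+-cong z≈fb z≈fb) (+-mono-< ε<z ε<z))
      fa≈fb : f a ≈ f b
      fa≈fb = meetsOnce (y , pos⇒≉0 0<y) a b fa∼y fb∼y

    ≈⇒inside : ∀ z → z ≈ y → (y - ε < z × z < y + ε)
    ≈⇒inside z z≈y = <-respʳ-≈ (sym z≈y) (-pos< y 0<ε) , <-respˡ-≈ (sym z≈y) (<+pos y 0<ε)

mainTheorem5 : ∀ {c ℓ₁ ℓ₂} (K : RealClosedField c ℓ₁ ℓ₂) →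
    let open RealClosedField K
        open RCF K
    in NonArchimedean → (S : ValueGroupEmbedding) →
       let open ValueGroupEmbedding S
       in (∀ (x : Carrier) → ∃ λ (y : Carrier) → (y ∈G) × (x < y))
          × (∀ (y : Carrier) → y ∈G → ∃ λ (ε : Carrier) →
               ∀ (z : Carrier) → z ∈G →
                 (((y - ε) < z × z < (y + ε)) → z ≈ y)
                 × (z ≈ y → ((y - ε) < z × z < (y + ε))))
mainTheorem5 K non-arch S = cofinal non-arch , isolated
  where open ValueGroupSectionFacts K S
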